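{- Let $\approx$ be an SCER on $\Sigma^*$ and $T$ a string. A $\approx$-cover $C$ of $T$ is primitive if and only if it is a shortest $\approx$-cover of $T$ (i.e., no $\approx$-cover of $T$ is shorter than $C$).
   Context: $\Sigma^*$ is the set of strings over an alphabet $\Sigma$. For a string $T$, $|T|$ is its length, $T[i:j]$ the substring from position $i$ to $j$, $T[:j]=T[1:j]$, $T[i:]=T[i:|T|]$. An SCER is an equivalence relation $\approx$ on $\Sigma^*$ such that $X\approx Y$ implies $|X|=|Y|$ and $X[i:j]\approx Y[i:j]$ for all $1\le i\le j\le|X|$. $\mathsf{Occ}_{P,T}=\{\,i : 1\le i\le |T|-|P|+1,\ P\approx T[i:i+|P|-1]\,\}$. A string $C$ of length $c$ is a $\approx$-cover of $T$ of length $n$ if there are $x_1,\dots,x_m\in\mathsf{Occ}_{C,T}$ with $x_1=1$, $x_m=n-c+1$ and $x_{i-1}<x_i\le x_{i-1}+c$ for all $1<i\le m$; it is proper if $c<n$. A string is primitive if it has no proper $\approx$-cover. -}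

module Defs where

open import Level using (Level; suc; _⊔_)
open import Data.Nat using (ℕ; _+_; _∸_; _≤_; _<_)
open import Data.List using (List; length; take; drop; head; last)
open import Data.List.Relation.Unary.All using (All)
open import Data.List.Relation.Unary.Linked using (Linked)
open import Data.Maybe using (just)
open import Data.Product using (Σ; _×_; ∃)
open import Relation.Nullary using (¬_)
open import Relation.Binary.Structures using (IsEquivalence)
open import Relation.Binary.PropositionalEquality using (_≡_)

-- T[i:j] (1-indexed, inclusive); empty when j < i.
substr : ∀ {a} {A : Set a} → ℕ → ℕ → List A → List A
substr i j X = take (j + 1 ∸ i) (drop (i ∸ 1) X)

record SCER {a} (Σ : Set a) ℓ : Set (a ⊔ Level.suc ℓ) where
  field
    _≈_       : List Σ → List Σ → Set ℓ
    isEquiv   : IsEquivalence _≈_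
    len-pres  : ∀ {X Y} → X ≈ Y → length X ≡ length Y
    sub-closed : ∀ {X Y} → X ≈ Y → ∀ i j → 1 ≤ i → i ≤ j → j ≤ length X →
                 substr i j X ≈ substr i j Y

module _ {a ℓ} {Σ : Set a} (E : SCER Σ ℓ) where
  open SCER E

  Occ : List Σ → List Σ → ℕ → Set ℓ
  Occ P T i = (1 ≤ i) × (i + length P ≤ length T + 1)
              × (P ≈ substr i (i + length P ∸ 1) T)

  IsCover : List Σ → List Σ → Set ℓ
  IsCover C T = ∃ λ (xs : List ℕ) →
      All (Occ C T) xs
    × head xs ≡ just 1
    × last xs ≡ just (length T ∸ length C + 1)
    × Linked (λ x y → (x < y) × (y ≤ x + length C)) xs

  IsProperCover : List Σ → List Σ → Set ℓ
  IsProperCover C T = IsCover C T × (length C < length T)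

  Primitive : List Σ → Set (a ⊔ ℓ)
  Primitive X = ∀ C → ¬ IsProperCover C X

  IsShortestCover : List Σ → List Σ → Set (a ⊔ ℓ)
  IsShortestCover C T = IsCover C T × (∀ D → IsCover D T → length C ≤ length D)

-- Covering is transitive: if D covers C and C covers T, then the D-occurrences inside the
-- C-occurrences of T form a D-cover of T, since consecutive C's overlap or abut.  Conversely,
-- if C and a shorter D both cover T, then D covers C: C is both a prefix and a suffix of T, the
-- D-occurrences of T that lie inside the prefix C are occurrences in C, and the last of them is
-- followed, within |D|, by the suffix D of T, which also is a suffix of C.  Hence a primitive
-- cover is a shortest one (a shorter cover of T would properly cover C), and a shortest cover is
-- primitive (a proper cover of C would be a shorter cover of T).
module Submission where

open import Defs
open import Data.List using (List; []; _∷_; length; take; drop; last)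
open import Data.List.Properties using (take-take; take-drop; drop-drop)
open import Data.List.Relation.Unary.All using (All; []; _∷_)
open import Data.List.Relation.Unary.Linked using (Linked; []; [-]; _∷_)
open import Data.Maybe using (just)
open import Data.Maybe.Properties using (just-injective)
open import Data.Nat using (ℕ; zero; suc; pred; _+_; _∸_; _⊓_; _≤_; _<_; z≤n; s≤s; s≤s⁻¹; z<s; _≟_; _≤?_; _<?_)
open import Data.Nat.Properties
open import Data.Product using (_×_; _,_; proj₁; ∃)
open import Relation.Nullary using (yes; no; contradiction)
open import Relation.Binary.Structures using (IsEquivalence)
open import Relation.Binary.PropositionalEquality
open ≡-Reasoning

m∸n+[n∸o]≡m∸o : ∀ {m n o} → o ≤ n → n ≤ m → (m ∸ n) + (n ∸ o) ≡ m ∸ o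
m∸n+[n∸o]≡m∸o {m} {n} {o} o≤n n≤m = begin
  (m ∸ n) + (n ∸ o) ≡⟨ sym (+-∸-assoc (m ∸ n) o≤n) ⟩
  (m ∸ n) + n ∸ o   ≡⟨ cong (_∸ o) (m∸n+n≡m n≤m) ⟩
  m ∸ o             ∎

take-drop-take : ∀ {a} {A : Set a} p y c (xs : List A) → y + p ≤ c →
                 take p (drop y (take c xs)) ≡ take p (drop y xs)
take-drop-take p y c xs y+p≤c = begin
  take p (drop y (take c xs))       ≡⟨ take-drop p y (take c xs) ⟩
  drop y (take (y + p) (take c xs)) ≡⟨ cong (drop y) (take-take (y + p) c xs) ⟩
  drop y (take ((y + p) ⊓ c) xs)    ≡⟨ cong (λ m → drop y (take m xs)) (m≤n⇒m⊓n≡m y+p≤c) ⟩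
  drop y (take (y + p) xs)          ≡⟨ take-drop p y xs ⟨
  take p (drop y xs)                ∎

substr≡take-drop : ∀ {a} {A : Set a} y p (xs : List A) →
                   substr (suc y) (y + p) xs ≡ take p (drop y xs)
substr≡take-drop y p xs =
  cong (λ m → take m (drop y xs)) (trans (cong (_∸ suc y) (+-comm (y + p) 1)) (m+n∸m≡n y p))

module _ {a ℓ} {A : Set a} (E : SCER A ℓ) where
  open SCER E
  open IsEquivalence isEquiv renaming (refl to ≈-refl; sym to ≈-sym; trans to ≈-trans)

  ≡⇒≈ : ∀ {X Y} → X ≡ Y → X ≈ Y
  ≡⇒≈ refl = ≈-refl

  ≈-window : ∀ {X Y} y p → X ≈ Y → y + p ≤ length X →
             take p (drop y X) ≈ take p (drop y Y)
  ≈-window y zero    _   _ = ≈-refl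
  ≈-window y (suc p) X≈Y y+p≤∣X∣ =
    subst₂ _≈_ (substr≡take-drop y (suc p) _) (substr≡take-drop y (suc p) _)
      (sub-closed X≈Y (suc y) (y + suc p) (s≤s z≤n) (m<m+n y z<s) y+p≤∣X∣)

  -- OccAt P T k is Occ E P T (1 + k): positions are 0-based from here on.
  OccAt : List A → List A → ℕ → Set ℓ
  OccAt P T k = (k + length P ≤ length T) × (P ≈ take (length P) (drop k T))

  occ-window : ∀ {C T x} y p → OccAt C T x → y + p ≤ length C →
               take p (drop y C) ≈ take p (drop (x + y) T)
  occ-window {C} {T} {x} y p (_ , C≈) y+p≤∣C∣ = ≈-trans (≈-window y p C≈ y+p≤∣C∣) (≡⇒≈ (begin
    take p (drop y (take (length C) (drop x T))) ≡⟨ take-drop-take p y (length C) (drop x T) y+p≤∣C∣ ⟩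
    take p (drop y (drop x T))                   ≡⟨ cong (take p) (drop-drop x y T) ⟩
    take p (drop (x + y) T)                      ∎))

  occ-compose : ∀ {C D T x y} → OccAt C T x → OccAt D C y → OccAt D T (x + y)
  occ-compose {D = D} {T} {x} {y} occC@(x+c≤n , _) (y+d≤c , D≈) =
    subst (_≤ length T) (sym (+-assoc x y (length D))) (≤-trans (+-monoʳ-≤ x y+d≤c) x+c≤n) ,
    ≈-trans D≈ (occ-window y (length D) occC y+d≤c)

  occ-restrict : ∀ {C D T x y} → OccAt C T x → OccAt D T (x + y) → y + length D ≤ length C →
                 OccAt D C y
  occ-restrict {D = D} {y = y} occC (_ , D≈) y+d≤c =
    y+d≤c , ≈-trans D≈ (≈-sym (occ-window y (length D) occC y+d≤c))

  -- CoverFrom P T 0 is a cover of T by P, with the position list made 0-based and inductive.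
  data CoverFrom (P T : List A) : ℕ → Set ℓ where
    end  : ∀ {k} → OccAt P T k → k ≡ length T ∸ length P → CoverFrom P T k
    step : ∀ {k} k′ → OccAt P T k → k < k′ → k′ ≤ k + length P → CoverFrom P T k′ →
           CoverFrom P T k

  occ-first : ∀ {P T k} → CoverFrom P T k → OccAt P T k
  occ-first (end occ _)        = occ
  occ-first (step _ occ _ _ _) = occ

  occ-last : ∀ {P T k} → CoverFrom P T k → OccAt P T (length T ∸ length P)
  occ-last {P} {T} (end occ k≡) = subst (OccAt P T) k≡ occ
  occ-last (step _ _ _ _ r)     = occ-last r

  cover-from-last : ∀ {P T k} → OccAt P T k → OccAt P T (length T ∸ length P) →
                    k ≤ length T ∸ length P → length T ∸ length P ≤ k + length P →
                    CoverFrom P T k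
  cover-from-last {P} {T} {k} occ occLast k≤ ≤k+p with k ≟ length T ∸ length P
  ... | yes k≡ = end occ k≡
  ... | no  k≢ = step _ occ (≤∧≢⇒< k≤ k≢) ≤k+p (end occLast refl)

  advance-past : ∀ {P T z} p → CoverFrom P T z → z ≤ p + length P → p < length T ∸ length P →
                 ∃ λ z′ → (p < z′) × (z′ ≤ p + length P) × CoverFrom P T z′
  advance-past {z = z} p r z≤ p< with p <? z
  ... | yes p<z = z , p<z , z≤ , r
  advance-past p (end _ z≡) _ p< | no p≮z = contradiction (subst (p <_) (sym z≡) p<) p≮z
  advance-past {P} p (step _ _ _ z′≤ r) _ p< | no p≮z =
    advance-past p r (≤-trans z′≤ (+-monoˡ-≤ (length P) (≮⇒≥ p≮z))) p<

  occ-in-prefix : ∀ {C D T y} → OccAt C T 0 → OccAt D C (length C ∸ length D) →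
                  OccAt D T y → y ≤ length C ∸ length D → OccAt D C y
  occ-in-prefix {D = D} prefix suffix occ y≤ =
    occ-restrict prefix occ (≤-trans (+-monoˡ-≤ (length D) y≤) (proj₁ suffix))

  coverFrom-restrict : ∀ {C D T} → OccAt C T 0 → OccAt D C (length C ∸ length D) →
             ∀ {y} → CoverFrom D T y → y ≤ length C ∸ length D → CoverFrom D C y
  coverFrom-restrict {C} {D} prefix suffix (end occ y≡) y≤ =
    end (occ-in-prefix prefix suffix occ y≤)
      (≤-antisym y≤ (subst (length C ∸ length D ≤_) (sym y≡) (∸-monoˡ-≤ (length D) (proj₁ prefix))))
  coverFrom-restrict {C} {D} prefix suffix (step y′ occ y<y′ y′≤ r) y≤ with y′ ≤? length C ∸ length D
  ... | yes y′≤ₛ = step y′ (occ-in-prefix prefix suffix occ y≤) y<y′ y′≤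
                     (coverFrom-restrict prefix suffix r y′≤ₛ)
  ... | no  y′≰ₛ = cover-from-last (occ-in-prefix prefix suffix occ y≤) suffix y≤
                     (≤-trans (<⇒≤ (≰⇒> y′≰ₛ)) y′≤)

  coverFrom-compose : ∀ {C D T} → CoverFrom D C 0 → ∀ {x} → CoverFrom C T x →
            ∀ {y} → CoverFrom D C y → CoverFrom D T (x + y)
  coverFrom-compose {C} {D} {T} _ {x} (end occC x≡) {y} (end occD y≡) =
    end (occ-compose occC occD) (begin
      x + y                                         ≡⟨ cong₂ _+_ x≡ y≡ ⟩
      (length T ∸ length C) + (length C ∸ length D) ≡⟨ m∸n+[n∸o]≡m∸o d≤c c≤n ⟩
      length T ∸ length D                           ∎)
    where
      d≤c = m+n≤o⇒n≤o y (proj₁ occD)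
      c≤n = m+n≤o⇒n≤o x (proj₁ occC)
  coverFrom-compose {D = D} rDC {x} rC {y} (step y′ occD y<y′ y′≤ rD) =
    step (x + y′) (occ-compose (occ-first rC) occD) (+-monoʳ-< x y<y′)
      (subst (x + y′ ≤_) (sym (+-assoc x y (length D))) (+-monoʳ-≤ x y′≤)) (coverFrom-compose rDC rC rD)
  -- The last D inside the C at x is followed by the D's of the cover starting at the next C.
  coverFrom-compose {C} {D} {T} rDC {x} (step x′ occC x<x′ x′≤ rC) {y} (end occD y≡)
    with advance-past (x + y) (subst (CoverFrom D T) (+-identityʳ x′) (coverFrom-compose rDC rC rDC))
                      x′≤′ x+y<
    where
      x+c≡ : x + length C ≡ x + y + length D
      x+c≡ = begin
        x + length C                         ≡⟨ cong (x +_) (m∸n+n≡m (m+n≤o⇒n≤o y (proj₁ occD))) ⟨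
        x + (length C ∸ length D + length D) ≡⟨ cong (λ m → x + (m + length D)) y≡ ⟨
        x + (y + length D)                   ≡⟨ +-assoc x y (length D) ⟨
        x + y + length D                     ∎
      x′≤′ : x′ ≤ x + y + length D
      x′≤′ = subst (x′ ≤_) x+c≡ x′≤
      x+y< : x + y < length T ∸ length D
      x+y< = m+n≤o⇒m≤o∸n (suc (x + y)) (subst (_≤ length T) (cong suc x+c≡)
               (≤-trans (+-monoˡ-≤ (length C) x<x′) (proj₁ (occ-first rC))))
  ... | z , x+y<z , z≤ , rz = step z (occ-compose occC occD) x+y<z z≤ rz

  occ⇒occAt : ∀ {P T k} → Occ E P T (suc k) → OccAt P T k
  occ⇒occAt {P} {T} {k} (_ , k+p≤n+1 , P≈) =
    s≤s⁻¹ (subst (suc k + length P ≤_) (+-comm (length T) 1) k+p≤n+1) ,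
    subst (P ≈_) (substr≡take-drop k (length P) T) P≈

  occAt⇒occ : ∀ {P T k} → OccAt P T k → Occ E P T (suc k)
  occAt⇒occ {P} {T} {k} (k+p≤n , P≈) =
    s≤s z≤n , subst (suc k + length P ≤_) (+-comm 1 (length T)) (s≤s k+p≤n) ,
    subst (P ≈_) (sym (substr≡take-drop k (length P) T)) P≈

  positions⇒coverFrom : ∀ {P T} x xs → All (Occ E P T) (x ∷ xs) →
    Linked (λ u v → (u < v) × (v ≤ u + length P)) (x ∷ xs) →
    last (x ∷ xs) ≡ just (length T ∸ length P + 1) → CoverFrom P T (pred x)
  positions⇒coverFrom zero xs ((() , _) ∷ _) _ _
  positions⇒coverFrom {P} {T} (suc k) [] (occ ∷ []) _ last≡ =
    end (occ⇒occAt occ) (suc-injective (trans (just-injective last≡) (+-comm (length T ∸ length P) 1)))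
  positions⇒coverFrom (suc k) (zero ∷ xs) _ ((() , _) ∷ _) _
  positions⇒coverFrom (suc k) (suc x ∷ xs) (occ ∷ occs) ((k<x , x≤) ∷ linked) last≡ =
    step x (occ⇒occAt occ) (s≤s⁻¹ k<x) (s≤s⁻¹ x≤) (positions⇒coverFrom (suc x) xs occs linked last≡)

  coverFrom⇒positions : ∀ {P T k} → CoverFrom P T k → ∃ λ xs →
    All (Occ E P T) (suc k ∷ xs) ×
    Linked (λ u v → (u < v) × (v ≤ u + length P)) (suc k ∷ xs) ×
    (last (suc k ∷ xs) ≡ just (length T ∸ length P + 1))
  coverFrom⇒positions {P} {T} (end occ k≡) =
    [] , occAt⇒occ occ ∷ [] , [-] , cong just (trans (cong suc k≡) (+-comm 1 (length T ∸ length P)))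
  coverFrom⇒positions (step k′ occ k<k′ k′≤ r) with coverFrom⇒positions r
  ... | xs , occs , linked , last≡ =
    suc k′ ∷ xs , occAt⇒occ occ ∷ occs , (s≤s k<k′ , s≤s k′≤) ∷ linked , last≡

  cover⇒coverFrom : ∀ {C T} → IsCover E C T → CoverFrom C T 0
  cover⇒coverFrom ([] , _ , () , _)
  cover⇒coverFrom (x ∷ xs , occs , refl , last≡ , linked) = positions⇒coverFrom x xs occs linked last≡

  coverFrom⇒cover : ∀ {C T} → CoverFrom C T 0 → IsCover E C T
  coverFrom⇒cover r with coverFrom⇒positions r
  ... | xs , occs , linked , last≡ = 1 ∷ xs , occs , refl , last≡ , linked

  cover-trans : ∀ {C D T} → IsCover E D C → IsCover E C T → IsCover E D T
  cover-trans D-C C-T = coverFrom⇒cover (coverFrom-compose rD (cover⇒coverFrom C-T) rD)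
    where rD = cover⇒coverFrom D-C

  shorter-cover-covers : ∀ {C D T} → IsCover E C T → IsCover E D T → length D ≤ length C →
                         IsCover E D C
  shorter-cover-covers {C} {D} {T} C-T D-T d≤c =
    coverFrom⇒cover (coverFrom-restrict (occ-first rC) suffix rD z≤n)
    where
      rC = cover⇒coverFrom C-T
      rD = cover⇒coverFrom D-T
      suffix : OccAt D C (length C ∸ length D)
      suffix = occ-restrict (occ-last rC)
        (subst (OccAt D T) (sym (m∸n+[n∸o]≡m∸o d≤c (proj₁ (occ-first rC)))) (occ-last rD))
        (≤-reflexive (m∸n+n≡m d≤c))

lemma6 : ∀ {a ℓ} {Σ : Set a} (E : SCER Σ ℓ) (T C : List Σ) →
    IsCover E C T →
    ((Primitive E C → IsShortestCover E C T) × (IsShortestCover E C T → Primitive E C))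
lemma6 E T C C-T = primitive⇒shortest , shortest⇒primitive
  where
    primitive⇒shortest : Primitive E C → IsShortestCover E C T
    primitive⇒shortest prim = C-T , λ D D-T → ≮⇒≥ λ d<c →
      prim D (shorter-cover-covers E C-T D-T (<⇒≤ d<c) , d<c)

    shortest⇒primitive : IsShortestCover E C T → Primitive E C
    shortest⇒primitive (_ , shortest) D (D-C , d<c) = <⇒≱ d<c (shortest D (cover-trans E D-C C-T))
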